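{- Let $\Sigma$ be a set of program states, $\mathsf{Prop}$ a set of atomic assertions with a satisfaction relation $\vDash_\Sigma\subseteq\Sigma\times\mathsf{Prop}$, and let $C$ be a program with nondeterministic denotation $[\![C]\!]:\Sigma\to 2^\Sigma$. Then for all atomic assertions $P,Q\in\mathsf{Prop}$, \[\vDash\{P\}\,C\,\{Q\}\quad\text{iff}\quad \vDash\langle P\rangle\, C\,\langle Q\vee\top^\oplus\rangle .\]
   Context: Hoare triple: $\vDash\{P\}C\{Q\}$ iff for every $\sigma\in\Sigma$ with $\sigma\vDash_\Sigma P$ and every $\tau\in[\![C]\!](\sigma)$, $\tau\vDash_\Sigma Q$. Nondeterministic Outcome Logic: outcomes are sets $S\in 2^\Sigma$; the lifted semantics is $[\![C]\!]^\dagger(S)=\bigcup_{\sigma\in S}[\![C]\!](\sigma)$. Outcome assertions are $\varphi::=\top\mid\bot\mid\top^\oplus\mid\varphi\land\psi\mid\varphi\oplus\psi\mid\varphi\Rightarrow\psi\mid P$ ($P\in\mathsf{Prop}$) with satisfaction by sets $S$: $\top$ always; $\bot$ never; $S\vDash\top^\oplus$ iff $S=\emptyset$; $\land$ as usual; $S\vDash\varphi\oplus\psi$ iff $S=S_1\cup S_2$ for some $S_1\vDash\varphi$, $S_2\vDash\psi$; $S\vDash\varphi\Rightarrow\psi$ iff $S\vDash\varphi$ implies $S\vDash\psi$; $S\vDash P$ iff $S\neq\emptyset$ and $\sigma\vDash_\Sigma P$ for all $\sigma\in S$. Negation $\lnot\varphi:=\varphi\Rightarrow\bot$ and $\varphi\vee\psi:=\lnot(\lnot\varphi\land\lnot\psi)$.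 An Outcome Logic triple $\vDash\langle\varphi\rangle C\langle\psi\rangle$ holds iff for all $S\in2^\Sigma$, $S\vDash\varphi$ implies $[\![C]\!]^\dagger(S)\vDash\psi$. -}

module Defs where

open import Data.Empty using (⊥)
open import Data.Unit using (⊤)
open import Data.Sum using (_⊎_)
open import Data.Product using (Σ; ∃; _×_)
open import Relation.Nullary using (¬_)
open import Level using (Level; suc; _⊔_)

𝒫 : Set → Set₁
𝒫 St = St → Set

_≐_ : {St : Set} → 𝒫 St → 𝒫 St → Set
_≐_ {St} S T = (σ : St) → ((S σ → T σ) × (T σ → S σ))

_∪_ : {St : Set} → 𝒫 St → 𝒫 St → 𝒫 St
(S ∪ T) σ = S σ ⊎ T σ

data OA (At : Set) : Set where
  top     : OA At
  bot     : OA At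
  top⊕    : OA At
  _∧ₒ_    : OA At → OA At → OA At
  _⊕_     : OA At → OA At → OA At
  _⇒ₒ_    : OA At → OA At → OA At
  atom    : At → OA At

¬ₒ_ : {At : Set} → OA At → OA At
¬ₒ φ = φ ⇒ₒ bot

_∨ₒ_ : {At : Set} → OA At → OA At → OA At
φ ∨ₒ ψ = ¬ₒ ((¬ₒ φ) ∧ₒ (¬ₒ ψ))

module _ {St At : Set} (sat : St → At → Set) where

  _⊨ₒ_ : 𝒫 St → OA At → Set₁
  S ⊨ₒ top      = Level.Lift _ ⊤
  S ⊨ₒ bot      = Level.Lift _ ⊥
  S ⊨ₒ top⊕     = Level.Lift _ ((σ : St) → ¬ S σ)
  S ⊨ₒ (φ ∧ₒ ψ) = (S ⊨ₒ φ) × (S ⊨ₒ ψ)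
  S ⊨ₒ (φ ⊕ ψ)  = Σ (𝒫 St) λ S₁ → Σ (𝒫 St) λ S₂ →
                    (S ≐ (S₁ ∪ S₂)) × (S₁ ⊨ₒ φ) × (S₂ ⊨ₒ ψ)
  S ⊨ₒ (φ ⇒ₒ ψ) = S ⊨ₒ φ → S ⊨ₒ ψ
  S ⊨ₒ atom P   = Level.Lift _ ((∃ λ σ → S σ) × ((σ : St) → S σ → sat σ P))

lift† : {St : Set} → (St → 𝒫 St) → 𝒫 St → 𝒫 St
lift† C S τ = ∃ λ σ → S σ × C σ τ

HoareTriple : {St At : Set} → (St → At → Set) → At → (St → 𝒫 St) → At → Set
HoareTriple {St} sat P C Q =
  (σ : St) → sat σ P → (τ : St) → C σ τ → sat τ Q

OLTriple : {St At : Set} → (St → At → Set) → OA At → (St → 𝒫 St) → OA At → Set₁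
OLTriple {St} sat φ C ψ =
  (S : 𝒫 St) → _⊨ₒ_ sat S φ → _⊨ₒ_ sat (lift† C S) ψ

-- A set satisfies atom Q ∨ₒ top⊕ exactly when every state in it satisfies Q: it is either a
-- nonempty set of Q-states or empty. Hence the outcome triple says that every reachable state
-- satisfies Q, which is the Hoare triple; the converse direction runs the outcome triple on a
-- singleton. Excluded middle enters because ∨ₒ is defined by De Morgan from ∧ₒ and negation.
module Submission where

open import Defs
open import Axiom.ExcludedMiddle using (ExcludedMiddle)
open import Data.Empty using (⊥; ⊥-elim)
open import Data.Product using (_×_; _,_; ∃)
open import Data.Sum using (_⊎_; inj₁; inj₂)
open import Level using (_⊔_; Lift; lift; lower)
open import Relation.Nullary using (¬_; yes; no)
open import Relation.Nullary.Decidable using (map′)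
open import Relation.Binary.PropositionalEquality using (_≡_; refl)

excludedMiddle-lower : ∀ {a} ℓ → ExcludedMiddle (a ⊔ ℓ) → ExcludedMiddle a
excludedMiddle-lower ℓ em {P} = map′ lower lift (em {Lift ℓ P})

｛_｝ : {St : Set} → St → 𝒫 St
｛ σ ｝ τ = τ ≡ σ

module _ {St At : Set} (sat : St → At → Set) where

  private
    infix 4 _⊨_
    _⊨_ : 𝒫 St → OA At → Set₁
    _⊨_ = _⊨ₒ_ sat

  ⊨-∨ₒ-intro : {S : 𝒫 St} {φ ψ : OA At} → S ⊨ φ ⊎ S ⊨ ψ → S ⊨ φ ∨ₒ ψ
  ⊨-∨ₒ-intro (inj₁ s⊨φ) (s⊭φ , _) = s⊭φ s⊨φ
  ⊨-∨ₒ-intro (inj₂ s⊨ψ) (_ , s⊭ψ) = s⊭ψ s⊨ψ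

  ⊨-∨ₒ-elim : {S : 𝒫 St} {φ ψ : OA At} → S ⊨ φ ∨ₒ ψ → ¬ S ⊨ φ → ¬ S ⊨ ψ → ⊥
  ⊨-∨ₒ-elim s⊨φ∨ψ s⊭φ s⊭ψ =
    lower (s⊨φ∨ψ ((λ s⊨φ → lift (s⊭φ s⊨φ)) , (λ s⊨ψ → lift (s⊭ψ s⊨ψ))))

  ∈⇒⊭top⊕ : {S : 𝒫 St} {σ : St} → S σ → ¬ S ⊨ top⊕
  ∈⇒⊭top⊕ {σ = σ} σ∈S (lift empty) = empty σ σ∈S

  ∈-⊭⇒⊭atom : {S : 𝒫 St} {σ : St} {Q : At} → S σ → ¬ sat σ Q → ¬ S ⊨ atom Q
  ∈-⊭⇒⊭atom {σ = σ} σ∈S σ⊭Q (lift (_ , all⊨Q)) = σ⊭Q (all⊨Q σ σ∈S)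

  ｛｝⊨atom : {σ : St} {P : At} → sat σ P → ｛ σ ｝ ⊨ atom P
  ｛｝⊨atom {σ} σ⊨P = lift ((σ , refl) , λ { _ refl → σ⊨P })

  ⊨-atom⊎top⊕ : ExcludedMiddle Level.zero → {S : 𝒫 St} {Q : At} →
                (∀ σ → S σ → sat σ Q) → S ⊨ atom Q ⊎ S ⊨ top⊕
  ⊨-atom⊎top⊕ em {S} all⊨Q with em {∃ S}
  ... | yes nonempty = inj₁ (lift (nonempty , all⊨Q))
  ... | no empty     = inj₂ (lift λ σ σ∈S → empty (σ , σ∈S))

  module _ {C : St → 𝒫 St} {P Q : At} where

    hoare⇒lift†-⊨ : HoareTriple sat P C Q → {S : 𝒫 St} →
                    (∀ σ → S σ → sat σ P) → ∀ τ → lift† C S τ → sat τ Q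
    hoare⇒lift†-⊨ hoare all⊨P τ (σ , σ∈S , cστ) = hoare σ (all⊨P σ σ∈S) τ cστ

    hoare⇒ol : ExcludedMiddle Level.zero →
               HoareTriple sat P C Q → OLTriple sat (atom P) C (atom Q ∨ₒ top⊕)
    hoare⇒ol em hoare S (lift (_ , all⊨P)) =
      ⊨-∨ₒ-intro {lift† C S} {atom Q} {top⊕} (⊨-atom⊎top⊕ em (hoare⇒lift†-⊨ hoare all⊨P))

    -- Run the outcome triple on the singleton ｛ σ ｝: its image contains τ, so it is not empty,
    -- and it satisfies atom Q only if τ does.
    ol⇒hoare : ExcludedMiddle Level.zero →
               OLTriple sat (atom P) C (atom Q ∨ₒ top⊕) → HoareTriple sat P C Q
    ol⇒hoare em ol σ σ⊨P τ cστ with em {sat τ Q}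
    ... | yes τ⊨Q = τ⊨Q
    ... | no τ⊭Q  = ⊥-elim (⊨-∨ₒ-elim {lift† C ｛ σ ｝} {atom Q} {top⊕} (ol ｛ σ ｝ (｛｝⊨atom σ⊨P))
                                                    (∈-⊭⇒⊭atom τ∈image τ⊭Q) (∈⇒⊭top⊕ τ∈image))
      where
      τ∈image : lift† C ｛ σ ｝ τ
      τ∈image = σ , refl , cστ

theorem4p6 : ExcludedMiddle (Level.suc Level.zero) →
    (St At : Set) (sat : St → At → Set) (C : St → 𝒫 St) (P Q : At) →
    (HoareTriple sat P C Q → OLTriple sat (atom P) C ((atom Q) ∨ₒ top⊕)) × (OLTriple sat (atom P) C ((atom Q) ∨ₒ top⊕) → HoareTriple sat P C Q)
theorem4p6 em St At sat C P Q = hoare⇒ol sat em₀ , ol⇒hoare sat em₀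
  where
  em₀ : ExcludedMiddle Level.zero
  em₀ = excludedMiddle-lower (Level.suc Level.zero) em
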